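{- Let $p\ge2$, $m\in\{0,1,\ldots,p-1\}$ and $n\in\mathbb N$. In the weighted directed graph $G_p$ described in the context, there is a unique configuration of $n+1$ pairwise vertex-disjoint directed paths connecting the sources $A_m,A_{m+1},\ldots,A_{m+n}$ to the sinks $B_0,B_1,\ldots,B_n$ (each source to a distinct sink). In it, for each $i\in\{0,\ldots,n\}$, the source $A_{m+i}$ is connected to the sink $B_i$ by the highest possible path, which passes through $(-m,m+ip)$ (i.e. consists only of rises up to $(-m,m+ip)$ followed only by falls). The weight of this configuration (product of weights of all edges used) is $\prod_{i=0}^n\prod_{j=1}^{ip+m}V_j$.
   Context: $(V_l)_{l\ge1}$ are commuting formal variables. $G_p$ is the directed graph whose vertices are the pairs $(k,l)\in\mathbb Z\times\mathbb N$ with $k+l\equiv 0 \pmod p$ and whose edges are the rises $(k,l)\to(k+1,l+p-1)$, of weight $1$, and the falls $(k,l)\to(k+1,l-1)$ (for $l\ge1$), of weight $V_l$. For $n\in\mathbb N$ let $q_n=\lfloor n/(p-1)\rfloor$, $r_n=n-(p-1)q_n$, $A_n=(-pq_n-r_n,\,r_n)$ and $B_n=(np,0)$. -}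

module Defs where

open import Level using (Level)
open import Data.Nat as ℕ using (ℕ; zero; suc; _∸_; _≤_)
open import Data.Nat.DivMod using (_/_)
open import Data.Integer as ℤ using (ℤ; +_; -_)
open import Data.Fin using (Fin) renaming (zero to fzero; suc to fsuc)
open import Data.Fin.Base using (toℕ)
open import Data.List using (List; []; _∷_; _++_; replicate)
open import Data.List.Membership.Propositional using (_∈_)
open import Data.Product using (_×_; _,_; Σ; ∃; ∃₂)
open import Data.Unit using (⊤)
open import Data.Empty using (⊥)
open import Relation.Binary.PropositionalEquality using (_≡_; _≢_)
open import Function.Definitions using (Injective)
open import Algebra.Bundles using (CommutativeMonoid)

Vertex : Set
Vertex = ℤ × ℕ

-- q_n = ⌊ n / (p-1) ⌋  (only used for p ≥ 2; junk value 0 when p ≤ 1)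
qq : ℕ → ℕ → ℕ
qq p n with p ∸ 1
... | zero  = 0
... | suc d = n / suc d

rr : ℕ → ℕ → ℕ
rr p n = n ∸ ((p ∸ 1) ℕ.* qq p n)

A : ℕ → ℕ → Vertex
A p n = (- (+ (p ℕ.* qq p n ℕ.+ rr p n)) , rr p n)

B : ℕ → ℕ → Vertex
B p n = (+ (n ℕ.* p) , 0)

data Step : Set where
  rise fall : Step

step : ℕ → Vertex → Step → Vertex
step p (k , l) rise = (k ℤ.+ + 1 , l ℕ.+ (p ∸ 1))
step p (k , l) fall = (k ℤ.+ + 1 , l ∸ 1)

Valid : ℕ → Vertex → List Step → Set
Valid p v [] = ⊤
Valid p v (rise ∷ s) = Valid p (step p v rise) s
Valid p (k , l) (fall ∷ s) = (1 ≤ l) × Valid p (step p (k , l) fall) s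

endpoint : ℕ → Vertex → List Step → Vertex
endpoint p v [] = v
endpoint p v (x ∷ s) = endpoint p (step p v x) s

vertices : ℕ → Vertex → List Step → List Vertex
vertices p v [] = v ∷ []
vertices p v (x ∷ s) = v ∷ vertices p (step p v x) s

Path : ℕ → Vertex → Vertex → Set
Path p a b = Σ (List Step) (λ s → Valid p a s × endpoint p a s ≡ b)

record Config (p m n : ℕ) : Set where
  field
    σ     : Fin (suc n) → Fin (suc n)
    σ-inj : Injective _≡_ _≡_ σ
    path  : (i : Fin (suc n)) → Path p (A p (m ℕ.+ toℕ i)) (B p (toℕ (σ i)))

  steps : Fin (suc n) → List Step
  steps i = Σ.proj₁ (path i)

  verts : Fin (suc n) → List Vertex
  verts i = vertices p (A p (m ℕ.+ toℕ i)) (steps i)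

open Config public

Disjoint : ∀ {p m n} → Config p m n → Set
Disjoint C = ∀ i j → i ≢ j → ∀ v → v ∈ verts C i → v ∈ verts C j → ⊥

SameConfig : ∀ {p m n} → Config p m n → Config p m n → Set
SameConfig C D = (∀ i → σ C i ≡ σ D i) × (∀ i → steps C i ≡ steps D i)

RisesThenFalls : List Step → Set
RisesThenFalls s = ∃₂ λ a b → s ≡ replicate a rise ++ replicate b fall

module Weights {c ℓ : Level} (M : CommutativeMonoid c ℓ) where
  open CommutativeMonoid M renaming (Carrier to R)

  pathWeight : (V : ℕ → R) → ℕ → Vertex → List Step → R
  pathWeight V p v [] = ε
  pathWeight V p v (rise ∷ s) = pathWeight V p (step p v rise) s
  pathWeight V p (k , l) (fall ∷ s) = V l ∙ pathWeight V p (step p (k , l) fall) s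

  prodFin : (k : ℕ) → (Fin k → R) → R
  prodFin zero f = ε
  prodFin (suc k) f = f fzero ∙ prodFin k (λ i → f (fsuc i))

  prodV : (V : ℕ → R) → ℕ → R
  prodV V zero = ε
  prodV V (suc t) = prodV V t ∙ V (suc t)

  configWeight : ∀ {p m n} → (V : ℕ → R) → Config p m n → R
  configWeight {p} {m} {n} V C =
    prodFin (suc n) (λ i → pathWeight V p (A p (m ℕ.+ toℕ i)) (steps C i))

module Submission where

-- Write p = d + 1 and N = d·q_N + r_N, so that A_N lies
-- p·q_N + r_N = q_N + N columns left of the origin.  Every step moves one
-- column to the right, so a path from A_{m+i} meets the column -m after
-- exactly T_i = q_{m+i} + i steps.  Counting heights ("final height + length
-- = initial height + p·#rises") shows that it meets this column at a gate
-- vertex (-m, t·p + m) with t ≤ i, and that t = i only if those T_i steps are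
-- all rises.  A path from the gate t to the sink B_j needs t ≤ j, with
-- equality only if it consists of falls alone.  In a vertex-disjoint
-- configuration the gate indices t_i are injective with t_i ≤ i, hence t_i = i;
-- then i ≤ σ(i) for an injective σ forces σ = id, and every path is the
-- canonical "rises up to the gate, then falls" path.  Conversely the canonical
-- paths are disjoint, since their rising parts lie on distinct lines of slope
-- d and their falling parts on distinct lines of slope -1.  The file develops:
-- counting rises, general facts on paths in G_p, two lemmas on injective
-- self-maps of Fin n, the geometry of G_p for fixed p ≥ 2 and m < p, and
-- finally the theorem.

open import Defs
open import Level using (Level)
open import Data.Nat using (ℕ; zero; suc; _+_; _*_; _∸_; _≤_; _<_; s≤s; z≤n)
import Data.Nat.Properties as NP
open import Data.Nat.DivMod using (_/_; m/n*n≤m)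
open import Data.Nat.Tactic.RingSolver using (solve-∀)
open import Data.Integer as ℤ using (ℤ; +_; -_)
import Data.Integer.Properties as ZP
import Data.Integer.Tactic.RingSolver as ℤSolver
open import Algebra.Properties.AbelianGroup ZP.+-0-abelianGroup using (∙-cancelˡ; ∙-cancelʳ)
open import Data.Fin as Fin using (Fin; toℕ; fromℕ<; opposite)
import Data.Fin.Properties as FP
open import Data.List using (List; []; _∷_; _++_; replicate; length; take; drop)
import Data.List.Properties as LP
open import Data.List.Membership.Propositional using (_∈_)
open import Data.List.Relation.Unary.Any using (here; there)
open import Data.Product using (Σ; _×_; _,_; proj₁; proj₂)
open import Data.Product.Properties using (×-≡,≡→≡)
open import Data.Sum using (_⊎_; inj₁; inj₂)
open import Data.Unit using (tt)
open import Data.Empty using (⊥-elim)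
open import Relation.Nullary using (yes; no)
open import Relation.Binary.PropositionalEquality
open import Function.Definitions using (Injective)
open import Algebra.Bundles using (CommutativeMonoid)

rises : List Step → ℕ
rises []         = 0
rises (rise ∷ s) = suc (rises s)
rises (fall ∷ s) = rises s

rises≤length : ∀ s → rises s ≤ length s
rises≤length []         = z≤n
rises≤length (rise ∷ s) = s≤s (rises≤length s)
rises≤length (fall ∷ s) = NP.m≤n⇒m≤1+n (rises≤length s)

rises-replicate : ∀ a → rises (replicate a rise) ≡ a
rises-replicate zero    = refl
rises-replicate (suc a) = cong suc (rises-replicate a)

only-rises : ∀ s → rises s ≡ length s → s ≡ replicate (length s) rise
only-rises []         _  = refl
only-rises (rise ∷ s) eq = cong (rise ∷_) (only-rises s (NP.suc-injective eq))
only-rises (fall ∷ s) eq = ⊥-elim (NP.<⇒≱ (NP.≤-reflexive (sym eq)) (rises≤length s))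

only-falls : ∀ s → rises s ≡ 0 → s ≡ replicate (length s) fall
only-falls []         _  = refl
only-falls (fall ∷ s) eq = cong (fall ∷_) (only-falls s eq)

excess-rises≤ : ∀ q i s → length s ≡ q + i → rises s ∸ q ≤ i
excess-rises≤ q i s len =
  NP.m≤n+o⇒m∸n≤o (rises s) q (NP.≤-trans (rises≤length s) (NP.≤-reflexive len))

excess-rises-maximal : ∀ q i s → q ≤ rises s → length s ≡ q + i → rises s ∸ q ≡ i →
  s ≡ replicate (q + i) rise
excess-rises-maximal q i s q≤rises len excess =
  trans (only-rises s all-rises) (cong (λ k → replicate k rise) len)
  where
  open ≡-Reasoning
  all-rises : rises s ≡ length s
  all-rises = begin
    rises s             ≡⟨ NP.m+[n∸m]≡n q≤rises ⟨
    q + (rises s ∸ q)   ≡⟨ cong (λ k → q + k) excess ⟩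
    q + i               ≡⟨ len ⟨
    length s            ∎

split-at : ∀ {a} {X : Set a} k (xs : List X) → k ≤ length xs →
  Σ (List X) λ ys → Σ (List X) λ zs → xs ≡ ys ++ zs × length ys ≡ k
split-at k xs k≤length =
  take k xs , drop k xs , sym (LP.take++drop≡id k xs) ,
  trans (LP.length-take k xs) (NP.m≤n⇒m⊓n≡m k≤length)

column-walk : ∀ a b → - (+ (a + b)) ℤ.+ + a ≡ - (+ b)
column-walk a b = lemma (+ a) (+ b)
  where
  lemma : ∀ (a b : ℤ) → - (a ℤ.+ b) ℤ.+ a ≡ - b
  lemma = ℤSolver.solve-∀

column-arrival : ∀ a c → - (+ a) ℤ.+ + (c + a) ≡ + c
column-arrival a c = lemma (+ a) (+ c)
  where
  lemma : ∀ (a c : ℤ) → - a ℤ.+ (c ℤ.+ a) ≡ c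
  lemma = ℤSolver.solve-∀

column-arrival⁻¹ : ∀ a b c → - (+ a) ℤ.+ + b ≡ + c → b ≡ c + a
column-arrival⁻¹ a b c eq = ZP.+-injective (trans (lemma (+ a) (+ b)) (cong (ℤ._+ + a) eq))
  where
  lemma : ∀ (a b : ℤ) → b ≡ (- a ℤ.+ b) ℤ.+ a
  lemma = ℤSolver.solve-∀

-- Rises (slope d) preserve the level l - d·k, falls preserve k + l.
riseLevel : ℕ → Vertex → ℤ
riseLevel d (k , l) = + l ℤ.- + d ℤ.* k

fallLevel : Vertex → ℤ
fallLevel (k , l) = k ℤ.+ + l

riseLevel-cancel : ∀ d k {l l′} → riseLevel d (k , l) ≡ riseLevel d (k , l′) → l ≡ l′
riseLevel-cancel d k eq = ZP.+-injective (∙-cancelʳ (- (+ d ℤ.* k)) _ _ eq)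

fallLevel-cancel : ∀ k {l l′} → fallLevel (k , l) ≡ fallLevel (k , l′) → l ≡ l′
fallLevel-cancel k eq = ZP.+-injective (∙-cancelˡ k _ _ eq)

-- General facts on paths in G_p, valid for every p.

module _ (p : ℕ) where

  column-endpoint : ∀ v s → proj₁ (endpoint p v s) ≡ proj₁ v ℤ.+ + length s
  column-endpoint (k , l) []         = sym (ZP.+-identityʳ k)
  column-endpoint (k , l) (rise ∷ s) =
    trans (column-endpoint _ s) (ZP.+-assoc k (+ 1) (+ length s))
  column-endpoint (k , l) (fall ∷ s) =
    trans (column-endpoint _ s) (ZP.+-assoc k (+ 1) (+ length s))

  -- A rise gains p - 1 in height and a fall loses 1, so
  -- final height + length = initial height + p · #rises   (for p ≥ 1).
  height-balance : ∀ v s → Valid p v s →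
    proj₂ (endpoint p v s) + length s ≡ proj₂ v + suc (p ∸ 1) * rises s
  height-balance (k , l) [] _ = cong (λ k → l + k) (sym (NP.*-zeroʳ (suc (p ∸ 1))))
  height-balance (k , l) (rise ∷ s) valid = begin
    h + suc (length s)                            ≡⟨ NP.+-suc h (length s) ⟩
    suc (h + length s)                            ≡⟨ cong suc (height-balance _ s valid) ⟩
    suc (l + (p ∸ 1) + suc (p ∸ 1) * rises s)     ≡⟨ regroup l (p ∸ 1) (rises s) ⟩
    l + suc (p ∸ 1) * suc (rises s)               ∎
    where
    open ≡-Reasoning
    h : ℕ
    h = proj₂ (endpoint p (step p (k , l) rise) s)
    regroup : ∀ l d r → suc (l + d + suc d * r) ≡ l + suc d * suc r
    regroup = solve-∀
  height-balance (k , suc l) (fall ∷ s) (_ , valid) =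
    trans (NP.+-suc (proj₂ (endpoint p (k ℤ.+ + 1 , l) s)) (length s))
          (cong suc (height-balance _ s valid))

  valid-++⁻ : ∀ v s t → Valid p v (s ++ t) → Valid p v s × Valid p (endpoint p v s) t
  valid-++⁻ v       []         t valid = tt , valid
  valid-++⁻ v       (rise ∷ s) t valid = valid-++⁻ _ s t valid
  valid-++⁻ (k , l) (fall ∷ s) t (1≤l , valid) =
    let (valid-s , valid-t) = valid-++⁻ _ s t valid in (1≤l , valid-s) , valid-t

  valid-++⁺ : ∀ v s t → Valid p v s → Valid p (endpoint p v s) t → Valid p v (s ++ t)
  valid-++⁺ v       []         t _               valid-t = valid-t
  valid-++⁺ v       (rise ∷ s) t valid-s         valid-t = valid-++⁺ _ s t valid-s valid-t
  valid-++⁺ (k , l) (fall ∷ s) t (1≤l , valid-s) valid-t = 1≤l , valid-++⁺ _ s t valid-s valid-t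

  endpoint-++ : ∀ v s t → endpoint p v (s ++ t) ≡ endpoint p (endpoint p v s) t
  endpoint-++ v []      t = refl
  endpoint-++ v (x ∷ s) t = endpoint-++ _ s t

  vertices-++ : ∀ v s t {x} → x ∈ vertices p v (s ++ t) →
    x ∈ vertices p v s ⊎ x ∈ vertices p (endpoint p v s) t
  vertices-++ v []      t x∈          = inj₂ x∈
  vertices-++ v (y ∷ s) t (here eq)   = inj₁ (here eq)
  vertices-++ v (y ∷ s) t (there x∈) with vertices-++ _ s t x∈
  ... | inj₁ x∈s = inj₁ (there x∈s)
  ... | inj₂ x∈t = inj₂ x∈t

  endpoint∈ : ∀ v s t → endpoint p v s ∈ vertices p v (s ++ t)
  endpoint∈ v []      []      = here refl
  endpoint∈ v []      (x ∷ t) = here refl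
  endpoint∈ v (y ∷ s) t       = there (endpoint∈ _ s t)

  column-lower : ∀ v s {x} → x ∈ vertices p v s → proj₁ v ℤ.≤ proj₁ x
  column-lower v       []         (here refl) = ZP.≤-refl
  column-lower v       (y ∷ s)    (here refl) = ZP.≤-refl
  column-lower (k , l) (rise ∷ s) (there x∈)  = ZP.≤-trans (ZP.i≤i+j k (+ 1)) (column-lower _ s x∈)
  column-lower (k , l) (fall ∷ s) (there x∈)  = ZP.≤-trans (ZP.i≤i+j k (+ 1)) (column-lower _ s x∈)

  column-upper : ∀ v s {x} → x ∈ vertices p v s → proj₁ x ℤ.≤ proj₁ (endpoint p v s)
  column-upper v       []         (here refl) = ZP.≤-refl
  column-upper v       (y ∷ s)    (here refl) =
    subst (proj₁ v ℤ.≤_) (sym (column-endpoint v (y ∷ s))) (ZP.i≤i+j (proj₁ v) (+ suc (length s)))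
  column-upper (k , l) (rise ∷ s) (there x∈)  = column-upper _ s x∈
  column-upper (k , l) (fall ∷ s) (there x∈)  = column-upper _ s x∈

  rises-valid : ∀ a v → Valid p v (replicate a rise)
  rises-valid zero    v = tt
  rises-valid (suc a) v = rises-valid a _

  descent-valid : ∀ b k l → b ≤ l → Valid p (k , l) (replicate b fall)
  descent-valid zero    k l       _         = tt
  descent-valid (suc b) k (suc l) (s≤s b≤l) = s≤s z≤n , descent-valid b _ l b≤l

  descent-endpoint : ∀ b k → endpoint p (k , b) (replicate b fall) ≡ (k ℤ.+ + b , 0)
  descent-endpoint zero    k = cong (_, 0) (sym (ZP.+-identityʳ k))
  descent-endpoint (suc b) k =
    trans (descent-endpoint b (k ℤ.+ + 1)) (cong (_, 0) (ZP.+-assoc k (+ 1) (+ b)))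

  rise-run-level : ∀ a v {x} → x ∈ vertices p v (replicate a rise) →
    riseLevel (p ∸ 1) x ≡ riseLevel (p ∸ 1) v
  rise-run-level zero    v       (here refl) = refl
  rise-run-level (suc a) v       (here refl) = refl
  rise-run-level (suc a) (k , l) (there x∈)  =
    trans (rise-run-level a _ x∈) (lemma (+ l) (+ (p ∸ 1)) k)
    where
    lemma : ∀ (l d k : ℤ) → (l ℤ.+ d) ℤ.- d ℤ.* (k ℤ.+ ℤ.+ 1) ≡ l ℤ.- d ℤ.* k
    lemma = ℤSolver.solve-∀

  fall-run-level : ∀ b k l {x} → b ≤ l → x ∈ vertices p (k , l) (replicate b fall) →
    fallLevel x ≡ fallLevel (k , l)
  fall-run-level zero    k l       _         (here refl) = refl
  fall-run-level (suc b) k l       _         (here refl) = refl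
  fall-run-level (suc b) k (suc l) (s≤s b≤l) (there x∈)  =
    trans (fall-run-level b _ l b≤l x∈) (ZP.+-assoc k (+ 1) (+ l))

module _ {c ℓ : Level} (M : CommutativeMonoid c ℓ) where
  open CommutativeMonoid M
    using (_≈_; ∙-cong; ∙-congˡ; comm)
    renaming (Carrier to R; refl to ≈-refl; trans to ≈-trans)
  open Weights M

  prodFin-cong : ∀ k {f g : Fin k → R} → (∀ i → f i ≈ g i) → prodFin k f ≈ prodFin k g
  prodFin-cong zero    f≈g = ≈-refl
  prodFin-cong (suc k) f≈g = ∙-cong (f≈g Fin.zero) (prodFin-cong k (λ i → f≈g (Fin.suc i)))

  weight-after-rises : ∀ V p a v t →
    pathWeight V p v (replicate a rise ++ t) ≡ pathWeight V p (endpoint p v (replicate a rise)) t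
  weight-after-rises V p zero    v       t = refl
  weight-after-rises V p (suc a) (k , l) t = weight-after-rises V p a _ t

  descent-weight : ∀ V p b k → pathWeight V p (k , b) (replicate b fall) ≈ prodV V b
  descent-weight V p zero    k = ≈-refl
  descent-weight V p (suc b) k = ≈-trans (∙-congˡ (descent-weight V p b _)) (comm _ _)

-- An injective f : Fin k → ℕ with f a ≤ a for all a is the identity:
-- if f a < a then a' = f a has f a' = a' by induction, so a' = a.
injective-below-identity : ∀ {k} (f : Fin k → ℕ) → Injective _≡_ _≡_ f →
  (∀ a → f a ≤ toℕ a) → ∀ a → f a ≡ toℕ a
injective-below-identity {k} f injective below a = fixed (suc (toℕ a)) a (NP.n<1+n (toℕ a))
  where
  fixed : ∀ bound a → toℕ a < bound → f a ≡ toℕ a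
  fixed (suc bound) a (s≤s a≤bound) with NP.m≤n⇒m<n∨m≡n (below a)
  ... | inj₂ fa≡a = fa≡a
  ... | inj₁ fa<a = ⊥-elim (NP.<-irrefl (trans (sym toℕ-a′) (cong toℕ a′≡a)) fa<a)
    where
    fa<k : f a < k
    fa<k = NP.<-trans fa<a (FP.toℕ<n a)
    a′ : Fin k
    a′ = fromℕ< fa<k
    toℕ-a′ : toℕ a′ ≡ f a
    toℕ-a′ = FP.toℕ-fromℕ< fa<k
    a′≡a : a′ ≡ a
    a′≡a = injective (trans (fixed bound a′ (NP.<-≤-trans (subst (_< toℕ a) (sym toℕ-a′) fa<a) a≤bound))
                            toℕ-a′)

opposite-injective : ∀ {n} → Injective _≡_ _≡_ (opposite {n})
opposite-injective {n} {x} {y} eq = begin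
  x                       ≡⟨ FP.opposite-involutive x ⟨
  opposite (opposite x)   ≡⟨ cong opposite eq ⟩
  opposite (opposite y)   ≡⟨ FP.opposite-involutive y ⟩
  y                       ∎
  where open ≡-Reasoning

-- Dually, an injective σ : Fin n → Fin n with a ≤ σ a is the identity
-- (apply the previous lemma to σ conjugated by the reversal of Fin n).
injective-above-identity : ∀ {n} (σ : Fin n → Fin n) → Injective _≡_ _≡_ σ →
  (∀ a → toℕ a ≤ toℕ (σ a)) → ∀ a → σ a ≡ a
injective-above-identity {n} σ injective above = σ-fixed
  where
  mirrored : Fin n → ℕ
  mirrored j = toℕ (opposite (σ (opposite j)))
  mirrored-injective : Injective _≡_ _≡_ mirrored
  mirrored-injective eq = opposite-injective (injective (opposite-injective (FP.toℕ-injective eq)))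
  mirrored-below : ∀ j → mirrored j ≤ toℕ j
  mirrored-below j = begin
    toℕ (opposite (σ (opposite j)))  ≡⟨ FP.opposite-prop _ ⟩
    n ∸ suc (toℕ (σ (opposite j)))   ≤⟨ NP.∸-monoʳ-≤ n (s≤s (above (opposite j))) ⟩
    n ∸ suc (toℕ (opposite j))       ≡⟨ FP.opposite-prop (opposite j) ⟨
    toℕ (opposite (opposite j))      ≡⟨ cong toℕ (FP.opposite-involutive j) ⟩
    toℕ j                            ∎
    where open NP.≤-Reasoning
  mirrored-fixed : ∀ j → mirrored j ≡ toℕ j
  mirrored-fixed = injective-below-identity mirrored mirrored-injective mirrored-below
  σ-fixed : ∀ a → σ a ≡ a
  σ-fixed a = begin
    σ a                                            ≡⟨ cong σ (FP.opposite-involutive a) ⟨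
    σ (opposite (opposite a))                      ≡⟨ FP.opposite-involutive _ ⟨
    opposite (opposite (σ (opposite (opposite a))))
      ≡⟨ cong opposite (FP.toℕ-injective (mirrored-fixed (opposite a))) ⟩
    opposite (opposite a)                          ≡⟨ FP.opposite-involutive a ⟩
    a                                              ∎
    where open ≡-Reasoning

aligned-height : ∀ {p} h q m x → m < p → h + p * q ≡ m + p * x →
  q ≤ x × h ≡ (x ∸ q) * p + m
aligned-height {p} h q m x m<p eq = q≤x , height
  where
  q≤x : q ≤ x
  q≤x with q NP.≤? x
  ... | yes q≤x = q≤x
  ... | no  q≰x = ⊥-elim (NP.<-irrefl refl (begin-strict
    m + p * x   <⟨ NP.+-monoˡ-< (p * x) m<p ⟩
    p + p * x   ≡⟨ NP.*-suc p x ⟨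
    p * suc x   ≤⟨ NP.*-monoʳ-≤ p (NP.≰⇒> q≰x) ⟩
    p * q       ≤⟨ NP.m≤n+m (p * q) h ⟩
    h + p * q   ≡⟨ eq ⟩
    m + p * x   ∎))
    where open NP.≤-Reasoning
  regroup : ∀ m p q t → m + p * (q + t) ≡ t * p + m + p * q
  regroup = solve-∀
  height : h ≡ (x ∸ q) * p + m
  height = NP.+-cancelʳ-≡ (p * q) _ _ (begin
    h + p * q                  ≡⟨ eq ⟩
    m + p * x                  ≡⟨ cong (λ y → m + p * y) (NP.m+[n∸m]≡n q≤x) ⟨
    m + p * (q + (x ∸ q))      ≡⟨ regroup m p q (x ∸ q) ⟩
    (x ∸ q) * p + m + p * q    ∎)
    where open ≡-Reasoning

-- The geometry of G_p for p = e + 2 ≥ 2 and a fixed m < p; here d = p - 1.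

module Geometry (e m : ℕ) (m<p : m < suc (suc e)) where

  d p : ℕ
  d = suc e
  p = suc d

  q r : ℕ → ℕ
  q = qq p
  r = rr p

  quotient-remainder : ∀ N → d * q N + r N ≡ N
  quotient-remainder N = NP.m+[n∸m]≡n (subst (_≤ N) (NP.*-comm (N / d) d) (m/n*n≤m N d))

  Av : ℕ → Vertex
  Av i = A p (m + i)

  -- A path from A_{m+i} reaches column -m after T i steps.
  T : ℕ → ℕ
  T i = q (m + i) + i

  source-distance : ∀ i → p * q (m + i) + r (m + i) ≡ T i + m
  source-distance i = begin
    p * Q + r (m + i)           ≡⟨ NP.+-assoc Q (d * Q) (r (m + i)) ⟩
    Q + (d * Q + r (m + i))     ≡⟨ cong (λ k → Q + k) (quotient-remainder (m + i)) ⟩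
    Q + (m + i)                 ≡⟨ regroup Q m i ⟩
    T i + m                     ∎
    where
    open ≡-Reasoning
    Q : ℕ
    Q = q (m + i)
    regroup : ∀ Q m i → Q + (m + i) ≡ Q + i + m
    regroup = solve-∀

  gate : ℕ → Vertex
  gate t = (- (+ m) , t * p + m)

  first-leg : ∀ i s → Valid p (Av i) s → length s ≡ T i →
    q (m + i) ≤ rises s × endpoint p (Av i) s ≡ gate (rises s ∸ q (m + i))
  first-leg i s valid len = proj₁ aligned , ×-≡,≡→≡ (column , proj₂ aligned)
    where
    open ≡-Reasoning
    Q x h : ℕ
    Q = q (m + i)
    x = rises s
    h = proj₂ (endpoint p (Av i) s)
    column : proj₁ (endpoint p (Av i) s) ≡ - (+ m)
    column = begin
      proj₁ (endpoint p (Av i) s)                 ≡⟨ column-endpoint p (Av i) s ⟩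
      - (+ (p * Q + r (m + i))) ℤ.+ + length s    ≡⟨ cong₂ (λ a b → - (+ a) ℤ.+ + b) (source-distance i) len ⟩
      - (+ (T i + m)) ℤ.+ + T i                   ≡⟨ column-walk (T i) m ⟩
      - (+ m)                                     ∎
    regroup₁ : ∀ h Q i d → h + suc d * Q + i ≡ h + (Q + i) + d * Q
    regroup₁ = solve-∀
    regroup₂ : ∀ r y dQ → r + y + dQ ≡ dQ + r + y
    regroup₂ = solve-∀
    regroup₃ : ∀ m i y → m + i + y ≡ m + y + i
    regroup₃ = solve-∀
    balance : h + p * Q ≡ m + p * x
    balance = NP.+-cancelʳ-≡ i _ _ (begin
      h + p * Q + i               ≡⟨ regroup₁ h Q i d ⟩
      h + (Q + i) + d * Q         ≡⟨ cong (λ n → h + n + d * Q) len ⟨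
      h + length s + d * Q        ≡⟨ cong (_+ d * Q) (height-balance p (Av i) s valid) ⟩
      r (m + i) + p * x + d * Q   ≡⟨ regroup₂ (r (m + i)) (p * x) (d * Q) ⟩
      d * Q + r (m + i) + p * x   ≡⟨ cong (_+ p * x) (quotient-remainder (m + i)) ⟩
      m + i + p * x               ≡⟨ regroup₃ m i (p * x) ⟩
      m + p * x + i               ∎)
    aligned : Q ≤ x × h ≡ (x ∸ Q) * p + m
    aligned = aligned-height h Q m x m<p balance

  second-leg : ∀ t j s → Valid p (gate t) s → endpoint p (gate t) s ≡ B p j →
    t ≤ j × (t ≡ j → s ≡ replicate (j * p + m) fall)
  second-leg t j s valid ends = t≤j , straight
    where
    open ≡-Reasoning
    y : ℕ
    y = rises s
    len : length s ≡ j * p + m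
    len = column-arrival⁻¹ m (length s) (j * p)
      (trans (sym (column-endpoint p (gate t) s)) (cong proj₁ ends))
    regroup : ∀ a m b → a + m + b ≡ a + b + m
    regroup = solve-∀
    descent : j * p ≡ t * p + p * y
    descent = NP.+-cancelʳ-≡ m _ _ (begin
      j * p + m                          ≡⟨ len ⟨
      length s                           ≡⟨ cong (_+ length s) (cong proj₂ ends) ⟨
      proj₂ (endpoint p (gate t) s) + length s ≡⟨ height-balance p (gate t) s valid ⟩
      t * p + m + p * y                  ≡⟨ regroup (t * p) m (p * y) ⟩
      t * p + p * y + m                  ∎)
    t≤j : t ≤ j
    t≤j = NP.*-cancelʳ-≤ t j p
      (NP.≤-trans (NP.m≤m+n (t * p) (p * y)) (NP.≤-reflexive (sym descent)))
    straight : t ≡ j → s ≡ replicate (j * p + m) fall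
    straight t≡j = trans (only-falls s no-rises) (cong (λ k → replicate k fall) len)
      where
      py≡0 : p * y ≡ 0
      py≡0 = NP.+-cancelˡ-≡ (t * p) _ _ (begin
        t * p + p * y   ≡⟨ descent ⟨
        j * p           ≡⟨ cong (_* p) t≡j ⟨
        t * p           ≡⟨ NP.+-identityʳ (t * p) ⟨
        t * p + 0       ∎)
      no-rises : y ≡ 0
      no-rises = NP.m+n≡0⇒m≡0 y py≡0

  canonical : ℕ → List Step
  canonical i = replicate (T i) rise ++ replicate (i * p + m) fall

  record Crossing (i j : ℕ) (s : List Step) : Set where
    field
      level    : ℕ
      level≤i  : level ≤ i
      level≤j  : level ≤ j
      passes   : gate level ∈ vertices p (Av i) s
      straight : level ≡ i → level ≡ j → s ≡ canonical i

  reaches-gate-column : ∀ i j s → endpoint p (Av i) s ≡ B p j → T i ≤ length s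
  reaches-gate-column i j s ends =
    subst (T i ≤_) (sym length≡) (NP.≤-trans (NP.m≤m+n (T i) m) (NP.m≤n+m (T i + m) (j * p)))
    where
    open ≡-Reasoning
    length≡ : length s ≡ j * p + (T i + m)
    length≡ = column-arrival⁻¹ (T i + m) (length s) (j * p) (begin
      - (+ (T i + m)) ℤ.+ + length s   ≡⟨ cong (λ a → - (+ a) ℤ.+ + length s) (source-distance i) ⟨
      proj₁ (Av i) ℤ.+ + length s      ≡⟨ column-endpoint p (Av i) s ⟨
      proj₁ (endpoint p (Av i) s)      ≡⟨ cong proj₁ ends ⟩
      + (j * p)                        ∎)

  crossing : ∀ i j s → Valid p (Av i) s → endpoint p (Av i) s ≡ B p j → Crossing i j s
  crossing i j s valid ends with split-at (T i) s (reaches-gate-column i j s ends)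
  ... | s₁ , s₂ , refl , len₁ = record
    { level    = t
    ; level≤i  = excess-rises≤ (q (m + i)) i s₁ len₁
    ; level≤j  = proj₁ leg₂
    ; passes   = subst (_∈ vertices p (Av i) (s₁ ++ s₂)) (proj₂ leg₁) (endpoint∈ p (Av i) s₁ s₂)
    ; straight = λ t≡i t≡j → cong₂ _++_
        (excess-rises-maximal (q (m + i)) i s₁ (proj₁ leg₁) len₁ t≡i)
        (trans (proj₂ leg₂ t≡j) (cong (λ k → replicate (k * p + m) fall) (trans (sym t≡j) t≡i)))
    }
    where
    t : ℕ
    t = rises s₁ ∸ q (m + i)
    leg₁ : q (m + i) ≤ rises s₁ × endpoint p (Av i) s₁ ≡ gate t
    leg₁ = first-leg i s₁ (proj₁ (valid-++⁻ p (Av i) s₁ s₂ valid)) len₁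
    leg₂ : t ≤ j × (t ≡ j → s₂ ≡ replicate (j * p + m) fall)
    leg₂ = second-leg t j s₂
      (subst (λ v → Valid p v s₂) (proj₂ leg₁) (proj₂ (valid-++⁻ p (Av i) s₁ s₂ valid)))
      (trans (cong (λ v → endpoint p v s₂) (sym (proj₂ leg₁)))
             (trans (sym (endpoint-++ p (Av i) s₁ s₂)) ends))

  rise-to-gate : ∀ i → endpoint p (Av i) (replicate (T i) rise) ≡ gate i
  rise-to-gate i = trans
    (proj₂ (first-leg i (replicate (T i) rise) (rises-valid p (T i) (Av i)) (LP.length-replicate (T i))))
    (cong gate excess)
    where
    excess : rises (replicate (T i) rise) ∸ q (m + i) ≡ i
    excess = trans (cong (_∸ q (m + i)) (rises-replicate (T i))) (NP.m+n∸m≡n (q (m + i)) i)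

  canonical-valid : ∀ i → Valid p (Av i) (canonical i)
  canonical-valid i = valid-++⁺ p (Av i) (replicate (T i) rise) _ (rises-valid p (T i) (Av i))
    (subst (λ v → Valid p v (replicate (i * p + m) fall)) (sym (rise-to-gate i))
      (descent-valid p (i * p + m) (- (+ m)) (i * p + m) NP.≤-refl))

  canonical-endpoint : ∀ i → endpoint p (Av i) (canonical i) ≡ B p i
  canonical-endpoint i = begin
    endpoint p (Av i) (canonical i)
      ≡⟨ endpoint-++ p (Av i) (replicate (T i) rise) _ ⟩
    endpoint p (endpoint p (Av i) (replicate (T i) rise)) (replicate (i * p + m) fall)
      ≡⟨ cong (λ v → endpoint p v (replicate (i * p + m) fall)) (rise-to-gate i) ⟩
    endpoint p (gate i) (replicate (i * p + m) fall)
      ≡⟨ descent-endpoint p (i * p + m) (- (+ m)) ⟩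
    (- (+ m) ℤ.+ + (i * p + m) , 0)
      ≡⟨ cong (_, 0) (column-arrival m (i * p)) ⟩
    B p i ∎
    where open ≡-Reasoning

  canonical-passes-gate : ∀ i → gate i ∈ vertices p (Av i) (canonical i)
  canonical-passes-gate i =
    subst (_∈ vertices p (Av i) (canonical i)) (rise-to-gate i) (endpoint∈ p (Av i) (replicate (T i) rise) _)

  OnCanonical : ℕ → Vertex → Set
  OnCanonical i x = (riseLevel d x ≡ riseLevel d (gate i) × proj₁ x ℤ.≤ - (+ m))
                  ⊎ (fallLevel x ≡ fallLevel (gate i) × - (+ m) ℤ.≤ proj₁ x)

  on-canonical : ∀ i {x} → x ∈ vertices p (Av i) (canonical i) → OnCanonical i x
  on-canonical i {x} x∈ with vertices-++ p (Av i) (replicate (T i) rise) (replicate (i * p + m) fall) x∈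
  ... | inj₁ x∈rising = inj₁
    ( trans (rise-run-level p (T i) (Av i) x∈rising) (sym (rise-run-level p (T i) (Av i) gate∈rising))
    , subst (λ v → proj₁ x ℤ.≤ proj₁ v) (rise-to-gate i) (column-upper p (Av i) _ x∈rising) )
    where
    gate∈rising : gate i ∈ vertices p (Av i) (replicate (T i) rise)
    gate∈rising = subst₂ (λ v s → v ∈ vertices p (Av i) s) (rise-to-gate i) (LP.++-identityʳ _)
      (endpoint∈ p (Av i) (replicate (T i) rise) [])
  ... | inj₂ x∈falling = inj₂
    ( fall-run-level p (i * p + m) (- (+ m)) (i * p + m) NP.≤-refl x∈falling′
    , column-lower p (gate i) _ x∈falling′ )
    where
    x∈falling′ : x ∈ vertices p (gate i) (replicate (i * p + m) fall)
    x∈falling′ = subst (λ v → x ∈ vertices p v (replicate (i * p + m) fall)) (rise-to-gate i) x∈falling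

  gate-injective : ∀ {i j} → i * p + m ≡ j * p + m → i ≡ j
  gate-injective {i} {j} eq = NP.*-cancelʳ-≡ i j p (NP.+-cancelʳ-≡ m _ _ eq)

  -- Distinct canonical paths share no vertex: on a common column two level
  -- lines of the same kind differ, and a rising part meets a falling part
  -- only on column -m, i.e. at the gates.
  canonical-separated : ∀ i j x → OnCanonical i x → OnCanonical j x → i ≡ j
  canonical-separated i j (k , l) (inj₁ (ri , _)) (inj₁ (rj , _)) =
    gate-injective (riseLevel-cancel d (- (+ m)) (trans (sym ri) rj))
  canonical-separated i j (k , l) (inj₂ (fi , _)) (inj₂ (fj , _)) =
    gate-injective (fallLevel-cancel (- (+ m)) (trans (sym fi) fj))
  canonical-separated i j (k , l) (inj₁ (ri , k≤)) (inj₂ (fj , ≤k)) with ZP.≤-antisym k≤ ≤k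
  ... | refl = gate-injective (trans (sym (riseLevel-cancel d k ri)) (fallLevel-cancel k fj))
  canonical-separated i j (k , l) (inj₂ (fi , ≤k)) (inj₁ (rj , k≤)) with ZP.≤-antisym k≤ ≤k
  ... | refl = gate-injective (trans (sym (fallLevel-cancel k fi)) (riseLevel-cancel d k rj))

  canonical-config : (n : ℕ) → Config p m n
  canonical-config n = record
    { σ     = λ i → i
    ; σ-inj = λ eq → eq
    ; path  = λ i → canonical (toℕ i) , canonical-valid (toℕ i) , canonical-endpoint (toℕ i)
    }

  canonical-disjoint : ∀ n → Disjoint (canonical-config n)
  canonical-disjoint n i j i≢j x x∈i x∈j = i≢j (FP.toℕ-injective
    (canonical-separated (toℕ i) (toℕ j) x (on-canonical (toℕ i) x∈i) (on-canonical (toℕ j) x∈j)))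

  canonical-shape : ∀ n (i : Fin (suc n)) →
    σ (canonical-config n) i ≡ i
    × RisesThenFalls (steps (canonical-config n) i)
    × ((- (+ m) , m + toℕ i * p) ∈ verts (canonical-config n) i)
  canonical-shape n i =
    refl , (T (toℕ i) , toℕ i * p + m , refl) ,
    subst (λ h → (- (+ m) , h) ∈ vertices p (Av (toℕ i)) (canonical (toℕ i)))
      (NP.+-comm (toℕ i * p) m) (canonical-passes-gate (toℕ i))

  -- Uniqueness: the gate levels of a disjoint configuration are injective and
  -- bounded by the source index, hence equal to it; then σ only moves indices
  -- up, so σ = id, and every path is forced to be canonical.
  canonical-unique : ∀ {n} (D : Config p m n) → Disjoint D → SameConfig D (canonical-config n)
  canonical-unique {n} D disjoint =
    σ≡id , λ i → Crossing.straight (cross i) (level≡ i) (trans (level≡ i) (sym (cong toℕ (σ≡id i))))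
    where
    cross : ∀ i → Crossing (toℕ i) (toℕ (σ D i)) (steps D i)
    cross i = crossing (toℕ i) (toℕ (σ D i)) (steps D i)
      (proj₁ (proj₂ (path D i))) (proj₂ (proj₂ (path D i)))
    level : Fin (suc n) → ℕ
    level i = Crossing.level (cross i)
    level-injective : Injective _≡_ _≡_ level
    level-injective {a} {b} eq with a FP.≟ b
    ... | yes a≡b = a≡b
    ... | no  a≢b = ⊥-elim (disjoint a b a≢b (gate (level a)) (Crossing.passes (cross a))
                      (subst (λ t → gate t ∈ verts D b) (sym eq) (Crossing.passes (cross b))))
    level≡ : ∀ i → level i ≡ toℕ i
    level≡ = injective-below-identity level level-injective (λ i → Crossing.level≤i (cross i))
    σ≡id : ∀ i → σ D i ≡ i
    σ≡id = injective-above-identity (σ D) (σ-inj D)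
      (λ i → subst (_≤ toℕ (σ D i)) (level≡ i) (Crossing.level≤j (cross i)))

  module _ {c ℓ : Level} (M : CommutativeMonoid c ℓ) (V : ℕ → CommutativeMonoid.Carrier M) where
    open CommutativeMonoid M using (_≈_) renaming (trans to ≈-trans; reflexive to ≈-reflexive)
    open Weights M

    canonical-weight : ∀ n →
      configWeight V (canonical-config n) ≈ prodFin (suc n) (λ i → prodV V (toℕ i * p + m))
    canonical-weight n = prodFin-cong M (suc n) λ i → path-weight (toℕ i)
      where
      path-weight : ∀ i → pathWeight V p (Av i) (canonical i) ≈ prodV V (i * p + m)
      path-weight i = ≈-trans
        (≈-reflexive (trans (weight-after-rises M V p (T i) (Av i) (replicate (i * p + m) fall))
          (cong (λ v → pathWeight V p v (replicate (i * p + m) fall)) (rise-to-gate i))))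
        (descent-weight M V p (i * p + m) (- (+ m)))

proposition6 : {c ℓ : Level} (M : CommutativeMonoid c ℓ) (V : ℕ → CommutativeMonoid.Carrier M)
    (p : ℕ) → 2 ≤ p → (m : ℕ) → m < p → (n : ℕ) →
    Σ (Config p m n) λ C →
      Disjoint C
      × ((D : Config p m n) → Disjoint D → SameConfig D C)
      × ((i : Fin (suc n)) →
           σ C i ≡ i
           × RisesThenFalls (steps C i)
           × ((- (+ m) , m + toℕ i * p) ∈ verts C i))
      × CommutativeMonoid._≈_ M (Weights.configWeight M V C)
          (Weights.prodFin M (suc n) (λ i → Weights.prodV M V (toℕ i * p + m)))
proposition6 M V (suc (suc e)) (s≤s (s≤s z≤n)) m m<p n =
  canonical-config n , canonical-disjoint n , canonical-unique ,
  canonical-shape n , canonical-weight M V n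
  where open Geometry e m m<p
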